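{- Let $n$ be a positive integer and $H=([n],E)$ an $r$-uniform hypergraph with $r\ge2$. Then for all $0\le i\le n$, \[ \sum_{c=0}^{i}(-1)^c\binom{i}{c}\Big((i-c+2)^n-\#E\cdot(i-c+2)^{n-r+1}\Big)\le f_i(\chi_H(k+1))\le\sum_{c=0}^{i}(-1)^c\binom{i}{c}(i-c+2)^n. \]
   Context: A hypergraph $H=([n],E)$ has vertex set $[n]$ and a set $E$ of subsets of $[n]$ (edges); it is $r$-uniform if every edge has exactly $r$ elements. A proper $k$-coloring of $H$ is a map $c:[n]\to[k]$ such that no edge is monochromatic; $\chi_H(k)$ is the number of proper $k$-colorings (a polynomial in $k$). For a polynomial $p(k)$ of degree at most $n$, its $f$-vector is defined by $p(k)=\sum_{i=0}^{n}f_i(p)\binom{k-1}{i}$; $f_i(\chi_H(k+1))$ is the $f$-vector of $k\mapsto\chi_H(k+1)$. -}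

module Defs where

open import Data.Nat as ℕ using (ℕ; zero; suc; _∸_)
open import Data.Nat.Combinatorics using (_C_)
open import Data.Integer as ℤ using (ℤ; +_; -_; _+_; _*_)
open import Data.Fin using (Fin; zero; suc)
open import Data.Fin.Properties using (any?; all?)
import Data.Fin.Properties as FinP
open import Data.Fin.Subset using (Subset; _∈_; ∣_∣)
open import Data.Fin.Subset.Properties using (_∈?_)
open import Data.Vec using (Vec; []; _∷_; lookup)
open import Data.List using (List; []; _∷_; length; filter; concatMap; map)
open import Data.List.Relation.Unary.All using (All)
import Data.List.Relation.Unary.All as All
open import Data.List.Relation.Unary.Unique.Propositional using (Unique)
open import Data.Product using (Σ; _×_; _,_)
open import Relation.Nullary using (¬_; Dec; ¬?; _→-dec_)
open import Relation.Binary.PropositionalEquality using (_≡_)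

record Hypergraph (n : ℕ) : Set where
  field
    edges    : List (Subset n)
    distinct : Unique edges

open Hypergraph public

#E : ∀ {n} → Hypergraph n → ℕ
#E H = length (edges H)

Uniform : ∀ {n} → ℕ → Hypergraph n → Set
Uniform r H = All (λ e → ∣ e ∣ ≡ r) (edges H)

Coloring : ℕ → ℕ → Set
Coloring n k = Vec (Fin k) n

Monochromatic : ∀ {n k} → Coloring n k → Subset n → Set
Monochromatic {n} {k} c e = Σ (Fin k) λ a → ∀ (v : Fin n) → v ∈ e → lookup c v ≡ a

monochromatic? : ∀ {n k} (c : Coloring n k) (e : Subset n) → Dec (Monochromatic c e)
monochromatic? c e =
  any? λ a → all? λ v → (v ∈? e) →-dec (lookup c v FinP.≟ a)

Proper : ∀ {n k} → Hypergraph n → Coloring n k → Set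
Proper H c = All (λ e → ¬ Monochromatic c e) (edges H)

proper? : ∀ {n k} (H : Hypergraph n) (c : Coloring n k) → Dec (Proper H c)
proper? H c = All.all? (λ e → ¬? (monochromatic? c e)) (edges H)

allFins : (k : ℕ) → List (Fin k)
allFins zero = []
allFins (suc k) = zero ∷ map suc (allFins k)

allColorings : (n k : ℕ) → List (Coloring n k)
allColorings zero k = [] ∷ []
allColorings (suc n) k =
  concatMap (λ a → map (a ∷_) (allColorings n k)) (allFins k)

χ : ∀ {n} → Hypergraph n → ℕ → ℕ
χ {n} H k = length (filter (proper? H) (allColorings n k))

Σ[0…_] : ℕ → (ℕ → ℤ) → ℤ
Σ[0… zero ] f = f zero
Σ[0… suc m ] f = Σ[0… m ] f + f (suc m)

sgn : ℕ → ℤ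
sgn zero = + 1
sgn (suc c) = - sgn c

-- f is an f-vector (of length n+1) of the polynomial  k ↦ q(k), i.e.
--   q(k) = Σ_{i=0}^{n} f_i · C(k-1, i)   for all k ≥ 1 (written k = m+1).
IsFVector : ℕ → (ℕ → ℤ) → (ℕ → ℤ) → Set
IsFVector n q f = ∀ (m : ℕ) → q (suc m) ≡ Σ[0… n ] (λ i → f i * + (m C i))

module Submission where

open import Defs

-- For a weight w on colourings invariant under injective relabelling of the colours,
-- let X_w(K) be the total weight of the K-colourings and S_w(K, j) that of the
-- K-colourings using every colour 0, …, j-1.  Sorting by whether colour j is used gives
-- S_w(K+1, j) = S_w(K, j) + S_w(K+1, j+1), hence S_w(b+i, i) = Δ^i X_w(b), and by
-- pigeonhole S_w(K, j) = 0 for j > n.  With Newton's forward-difference formula,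
-- i ↦ S_w(i+2, i) is an f-vector of k ↦ X_w(k+1); it is the only one since the
-- binomials C(m, 0), …, C(m, n) are linearly independent.  For w = [c proper] this makes
-- f_i(χ_H(k+1)) a count of colourings; comparing w with 1 and with the union bound
-- [c proper] + Σ_e [e monochromatic] yields Δ^i K^n(2) and Δ^i K^(n-r+1)(2), the
-- alternating sums of the statement.

module FiniteSums where

  open import Data.Nat using (ℕ; zero; suc; _≤_; _<_; z≤n; s≤s)
  import Data.Nat.Properties as ℕP
  open import Data.Integer using (ℤ; 0ℤ; _+_; _-_; _*_)
  import Data.Integer.Properties as ℤP
  open import Data.Integer.Tactic.RingSolver using (solve-∀)
  open import Data.Sum using (inj₁; inj₂)
  open import Relation.Binary.PropositionalEquality
  open ≡-Reasoning

  Σ-cong : ∀ m {f g : ℕ → ℤ} → (∀ c → c ≤ m → f c ≡ g c) → Σ[0… m ] f ≡ Σ[0… m ] g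
  Σ-cong zero f≡g = f≡g 0 z≤n
  Σ-cong (suc m) f≡g =
    cong₂ _+_ (Σ-cong m (λ c c≤m → f≡g c (ℕP.m≤n⇒m≤1+n c≤m))) (f≡g (suc m) ℕP.≤-refl)

  Σ-zero : ∀ m → Σ[0… m ] (λ _ → 0ℤ) ≡ 0ℤ
  Σ-zero zero = refl
  Σ-zero (suc m) = cong (_+ 0ℤ) (Σ-zero m)

  Σ-+ : ∀ m (f g : ℕ → ℤ) → Σ[0… m ] (λ c → f c + g c) ≡ Σ[0… m ] f + Σ[0… m ] g
  Σ-+ zero f g = refl
  Σ-+ (suc m) f g =
    trans (cong (_+ (f (suc m) + g (suc m))) (Σ-+ m f g))
          (interchange (Σ[0… m ] f) (Σ[0… m ] g) (f (suc m)) (g (suc m)))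
    where
    interchange : ∀ (a b c d : ℤ) → a + b + (c + d) ≡ a + c + (b + d)
    interchange = solve-∀

  Σ-- : ∀ m (f g : ℕ → ℤ) → Σ[0… m ] (λ c → f c - g c) ≡ Σ[0… m ] f - Σ[0… m ] g
  Σ-- zero f g = refl
  Σ-- (suc m) f g =
    trans (cong (_+ (f (suc m) - g (suc m))) (Σ-- m f g))
          (interchange (Σ[0… m ] f) (Σ[0… m ] g) (f (suc m)) (g (suc m)))
    where
    interchange : ∀ (a b c d : ℤ) → a - b + (c - d) ≡ a + c - (b + d)
    interchange = solve-∀

  Σ-*ˡ : ∀ m (k : ℤ) (f : ℕ → ℤ) → Σ[0… m ] (λ c → k * f c) ≡ k * Σ[0… m ] f
  Σ-*ˡ zero k f = refl
  Σ-*ˡ (suc m) k f =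
    trans (cong (_+ k * f (suc m)) (Σ-*ˡ m k f)) (sym (ℤP.*-distribˡ-+ k _ _))

  Σ-shift : ∀ m (g : ℕ → ℤ) → Σ[0… suc m ] g ≡ g 0 + Σ[0… m ] (λ c → g (suc c))
  Σ-shift zero g = refl
  Σ-shift (suc m) g = begin
    Σ[0… suc m ] g + g (suc (suc m))
      ≡⟨ cong (_+ g (suc (suc m))) (Σ-shift m g) ⟩
    g 0 + Σ[0… m ] (λ c → g (suc c)) + g (suc (suc m))
      ≡⟨ ℤP.+-assoc (g 0) _ _ ⟩
    g 0 + Σ[0… suc m ] (λ c → g (suc c)) ∎

  Σ-shift-within : ∀ m (g : ℕ → ℤ) → g (suc m) ≡ 0ℤ →
    Σ[0… m ] g ≡ g 0 + Σ[0… m ] (λ c → g (suc c))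
  Σ-shift-within m g above = begin
    Σ[0… m ] g           ≡⟨ ℤP.+-identityʳ _ ⟨
    Σ[0… m ] g + 0ℤ      ≡⟨ cong (_+_ (Σ[0… m ] g)) above ⟨
    Σ[0… suc m ] g       ≡⟨ Σ-shift m g ⟩
    g 0 + Σ[0… m ] (λ c → g (suc c)) ∎

  Σ-truncate : ∀ m N (g : ℕ → ℤ) → (∀ i → m < i → g i ≡ 0ℤ) → m ≤ N →
    Σ[0… N ] g ≡ Σ[0… m ] g
  Σ-truncate m N g vanish m≤N with ℕP.m≤n⇒m<n∨m≡n m≤N
  Σ-truncate m N g vanish m≤N | inj₂ refl = refl
  Σ-truncate m (suc N) g vanish _ | inj₁ (s≤s m≤N) = begin
    Σ[0… N ] g + g (suc N)
      ≡⟨ cong₂ _+_ (Σ-truncate m N g vanish m≤N) (vanish (suc N) (s≤s m≤N)) ⟩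
    Σ[0… m ] g + 0ℤ
      ≡⟨ ℤP.+-identityʳ _ ⟩
    Σ[0… m ] g ∎

module Differences where

  open FiniteSums
  open import Data.Nat as ℕ using (ℕ; zero; suc; _≤_; _<_; _∸_; s≤s)
  import Data.Nat.Properties as ℕP
  open import Data.Nat.Combinatorics using (_C_; nCn≡1; k>n⇒nCk≡0; nCk+nC[k+1]≡[n+1]C[k+1])
  open import Data.Integer using (ℤ; +_; 0ℤ; _+_; _-_; _*_; -_)
  import Data.Integer.Properties as ℤP
  open import Data.Integer.Tactic.RingSolver using (solve-∀)
  open import Data.Sum using (inj₁; inj₂)
  open import Relation.Binary.PropositionalEquality
  open ≡-Reasoning

  Δ : ℕ → (ℕ → ℤ) → ℕ → ℤ
  Δ zero X b = X b
  Δ (suc i) X b = Δ i X (suc b) - Δ i X b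

  Δ-cong : ∀ i {X Y : ℕ → ℤ} → (∀ k → X k ≡ Y k) → ∀ b → Δ i X b ≡ Δ i Y b
  Δ-cong zero X≡Y b = X≡Y b
  Δ-cong (suc i) X≡Y b = cong₂ _-_ (Δ-cong i X≡Y (suc b)) (Δ-cong i X≡Y b)

  binomial-tail : ∀ m (A : ℕ → ℤ) i → m < i → A i * + (m C i) ≡ 0ℤ
  binomial-tail m A i m<i = trans (cong (λ z → A i * + z) (k>n⇒nCk≡0 m<i)) (ℤP.*-zeroʳ (A i))

  -- Pascal's rule C(m+1, c+1) = C(m, c) + C(m, c+1), summed against a sequence A.
  pascal-Σ : ∀ m (A : ℕ → ℤ) →
    Σ[0… m ] (λ c → (A c + A (suc c)) * + (m C c)) ≡ Σ[0… suc m ] (λ c → A c * + (suc m C c))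
  pascal-Σ m A = begin
    Σ[0… m ] (λ c → (A c + A (suc c)) * + (m C c))
      ≡⟨ Σ-cong m (λ c _ → ℤP.*-distribʳ-+ (+ (m C c)) (A c) (A (suc c))) ⟩
    Σ[0… m ] (λ c → A c * + (m C c) + A (suc c) * + (m C c))
      ≡⟨ Σ-+ m _ _ ⟩
    Σ[0… m ] (λ c → A c * + (m C c)) + P
      ≡⟨ cong (_+ P) (Σ-shift-within m _ (binomial-tail m A (suc m) (ℕP.n<1+n m))) ⟩
    first + Q + P
      ≡⟨ regroup first Q P ⟩
    first + (P + Q)
      ≡⟨ cong (_+_ first) (sym (Σ-+ m _ _)) ⟩
    first + Σ[0… m ] (λ c → A (suc c) * + (m C c) + A (suc c) * + (m C suc c))
      ≡⟨ cong (_+_ first) (Σ-cong m (λ c _ → pascal c)) ⟩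
    first + Σ[0… m ] (λ c → A (suc c) * + (suc m C suc c))
      ≡⟨ Σ-shift m (λ c → A c * + (suc m C c)) ⟨
    Σ[0… suc m ] (λ c → A c * + (suc m C c)) ∎
    where
    -- C(m, 0) = C(m+1, 0) = 1
    first : ℤ
    first = A 0 * + 1
    P Q : ℤ
    P = Σ[0… m ] (λ c → A (suc c) * + (m C c))
    Q = Σ[0… m ] (λ c → A (suc c) * + (m C suc c))
    regroup : ∀ (a q p : ℤ) → a + q + p ≡ a + (p + q)
    regroup = solve-∀
    pascal : ∀ c → A (suc c) * + (m C c) + A (suc c) * + (m C suc c) ≡ A (suc c) * + (suc m C suc c)
    pascal c = trans (sym (ℤP.*-distribˡ-+ (A (suc c)) (+ (m C c)) (+ (m C suc c))))
                     (cong (λ z → A (suc c) * + z) (nCk+nC[k+1]≡[n+1]C[k+1] m c))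

  Δ-explicit : ∀ i X b → Δ i X b ≡ Σ[0… i ] (λ c → sgn c * + (i C c) * X (i ∸ c ℕ.+ b))
  Δ-explicit zero X b = sym (ℤP.*-identityˡ (X b))
  Δ-explicit (suc i) X b = begin
    Δ i X (suc b) - Δ i X b
      ≡⟨ cong₂ _-_ (Δ-explicit i X (suc b)) (Δ-explicit i X b) ⟩
    Σ[0… i ] (λ c → term c (suc b)) - Σ[0… i ] (λ c → term c b)
      ≡⟨ Σ-- i _ _ ⟨
    Σ[0… i ] (λ c → term c (suc b) - term c b)
      ≡⟨ Σ-cong i difference ⟩
    Σ[0… i ] (λ c → (A c + A (suc c)) * + (i C c))
      ≡⟨ pascal-Σ i A ⟩
    Σ[0… suc i ] (λ c → A c * + (suc i C c))
      ≡⟨ Σ-cong (suc i) (λ c _ → reorder (sgn c) _ _) ⟩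
    Σ[0… suc i ] (λ c → sgn c * + (suc i C c) * X (suc i ∸ c ℕ.+ b)) ∎
    where
    term : ℕ → ℕ → ℤ
    term c b′ = sgn c * + (i C c) * X (i ∸ c ℕ.+ b′)
    A : ℕ → ℤ
    A c = sgn c * X (suc i ∸ c ℕ.+ b)
    reorder : ∀ (s x k : ℤ) → s * x * k ≡ s * k * x
    reorder = solve-∀
    combine : ∀ (s k x y : ℤ) → s * k * x - s * k * y ≡ (s * x + - s * y) * k
    combine = solve-∀
    index : ∀ c → c ≤ i → i ∸ c ℕ.+ suc b ≡ suc i ∸ c ℕ.+ b
    index c c≤i = trans (ℕP.+-suc (i ∸ c) b) (cong (ℕ._+ b) (sym (ℕP.+-∸-assoc 1 c≤i)))
    difference : ∀ c → c ≤ i → term c (suc b) - term c b ≡ (A c + A (suc c)) * + (i C c)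
    difference c c≤i rewrite index c c≤i = combine (sgn c) _ _ _

  newton : ∀ X m b → X (b ℕ.+ m) ≡ Σ[0… m ] (λ i → Δ i X b * + (m C i))
  newton X zero b = trans (cong X (ℕP.+-identityʳ b)) (sym (ℤP.*-identityʳ (X b)))
  newton X (suc m) b = begin
    X (b ℕ.+ suc m)
      ≡⟨ cong X (ℕP.+-suc b m) ⟩
    X (suc b ℕ.+ m)
      ≡⟨ newton X m (suc b) ⟩
    Σ[0… m ] (λ i → Δ i X (suc b) * + (m C i))
      ≡⟨ Σ-cong m (λ i _ → cong (_* + (m C i)) (add-difference (Δ i X (suc b)) (Δ i X b))) ⟩
    Σ[0… m ] (λ i → (Δ i X b + Δ (suc i) X b) * + (m C i))
      ≡⟨ pascal-Σ m (λ i → Δ i X b) ⟩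
    Σ[0… suc m ] (λ i → Δ i X b * + (suc m C i)) ∎
    where
    add-difference : ∀ (x y : ℤ) → x ≡ y + (x - y)
    add-difference = solve-∀

  -- The binomial coefficients C(m, 0), …, C(m, n), as functions of m, are linearly
  -- independent: evaluating at m = j sees only the coefficients d 0, …, d j.
  binomial-independent : ∀ n (d : ℕ → ℤ) → (∀ m → Σ[0… n ] (λ i → d i * + (m C i)) ≡ 0ℤ) →
    ∀ i → i ≤ n → d i ≡ 0ℤ
  binomial-independent n d vanishes i i≤n = below i i≤n i ℕP.≤-refl
    where
    at : ∀ j → j ≤ n → Σ[0… j ] (λ i → d i * + (j C i)) ≡ 0ℤ
    at j j≤n = trans (sym (Σ-truncate j n _ (binomial-tail j d) j≤n)) (vanishes j)
    diagonal : ∀ j → d j * + (j C j) ≡ d j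
    diagonal j = trans (cong (λ z → d j * + z) (nCn≡1 j)) (ℤP.*-identityʳ (d j))
    below : ∀ j → j ≤ n → ∀ i → i ≤ j → d i ≡ 0ℤ
    below zero 0≤n zero _ = trans (sym (diagonal 0)) (at 0 0≤n)
    below (suc j) j<n i i≤1+j with ℕP.m≤n⇒m<n∨m≡n i≤1+j
    ... | inj₁ (s≤s i≤j) = below j (ℕP.<⇒≤ j<n) i i≤j
    ... | inj₂ refl = begin
      d (suc j)                                         ≡⟨ diagonal (suc j) ⟨
      d (suc j) * + (suc j C suc j)                     ≡⟨ ℤP.+-identityˡ _ ⟨
      0ℤ + d (suc j) * + (suc j C suc j)                ≡⟨ cong (_+ d (suc j) * + (suc j C suc j)) lower ⟨
      Σ[0… suc j ] (λ k → d k * + (suc j C k))          ≡⟨ at (suc j) j<n ⟩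
      0ℤ ∎
      where
      lower : Σ[0… j ] (λ k → d k * + (suc j C k)) ≡ 0ℤ
      lower = trans (Σ-cong j (λ k k≤j → trans (cong (_* + (suc j C k)) (below j (ℕP.<⇒≤ j<n) k k≤j))
                                               (ℤP.*-zeroˡ (+ (suc j C k)))))
                    (Σ-zero j)

  fvector-unique : ∀ n (q f g : ℕ → ℤ) → IsFVector n q f → IsFVector n q g →
    ∀ i → i ≤ n → f i ≡ g i
  fvector-unique n q f g f-is g-is i i≤n =
    ℤP.i-j≡0⇒i≡j (f i) (g i) (binomial-independent n (λ i → f i - g i) difference i i≤n)
    where
    distrib : ∀ (x y k : ℤ) → (x - y) * k ≡ x * k - y * k
    distrib = solve-∀
    difference : ∀ m → Σ[0… n ] (λ i → (f i - g i) * + (m C i)) ≡ 0ℤ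
    difference m = begin
      Σ[0… n ] (λ i → (f i - g i) * + (m C i))
        ≡⟨ Σ-cong n (λ i _ → distrib (f i) (g i) _) ⟩
      Σ[0… n ] (λ i → f i * + (m C i) - g i * + (m C i))
        ≡⟨ Σ-- n _ _ ⟩
      Σ[0… n ] (λ i → f i * + (m C i)) - Σ[0… n ] (λ i → g i * + (m C i))
        ≡⟨ cong₂ _-_ (f-is m) (g-is m) ⟨
      q (suc m) - q (suc m)
        ≡⟨ ℤP.+-inverseʳ (q (suc m)) ⟩
      0ℤ ∎

module ColouringSums where

  open import Data.Nat using (ℕ; zero; suc; _+_; _*_; _^_; _≤_; z≤n)
  import Data.Nat.Properties as ℕP
  open import Data.Nat.Tactic.RingSolver using (solve-∀)
  open import Data.Bool using (Bool; true; false)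
  open import Data.Fin using (Fin; zero; suc)
  open import Data.Vec using ([]; _∷_)
  open import Data.List as L using (List; []; _∷_; length; filter; concatMap)
  import Data.List.Properties as LP
  open import Relation.Nullary using (does)
  open import Relation.Unary using (Pred; Decidable)
  open import Relation.Binary.PropositionalEquality
  open ≡-Reasoning

  ⟦_⟧ : Bool → ℕ
  ⟦ true ⟧ = 1
  ⟦ false ⟧ = 0

  ⟦⟧≤1 : ∀ b → ⟦ b ⟧ ≤ 1
  ⟦⟧≤1 true = ℕP.≤-refl
  ⟦⟧≤1 false = z≤n

  private variable A B : Set

  sumList : List A → (A → ℕ) → ℕ
  sumList [] w = 0
  sumList (x ∷ xs) w = w x + sumList xs w

  sumList-cong : ∀ (xs : List A) {w w′ : A → ℕ} → (∀ x → w x ≡ w′ x) → sumList xs w ≡ sumList xs w′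
  sumList-cong [] _ = refl
  sumList-cong (x ∷ xs) w≡w′ = cong₂ _+_ (w≡w′ x) (sumList-cong xs w≡w′)

  sumList-mono : ∀ (xs : List A) {w w′ : A → ℕ} → (∀ x → w x ≤ w′ x) → sumList xs w ≤ sumList xs w′
  sumList-mono [] _ = z≤n
  sumList-mono (x ∷ xs) w≤w′ = ℕP.+-mono-≤ (w≤w′ x) (sumList-mono xs w≤w′)

  sumList-+ : ∀ (xs : List A) (w w′ : A → ℕ) →
    sumList xs (λ x → w x + w′ x) ≡ sumList xs w + sumList xs w′
  sumList-+ [] w w′ = refl
  sumList-+ (x ∷ xs) w w′ =
    trans (cong (w x + w′ x +_) (sumList-+ xs w w′)) (interchange (w x) (w′ x) _ _)
    where
    interchange : ∀ a b c d → a + b + (c + d) ≡ a + c + (b + d)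
    interchange = solve-∀

  sumList-* : ∀ (xs : List A) k (w : A → ℕ) → sumList xs (λ x → k * w x) ≡ k * sumList xs w
  sumList-* [] k w = sym (ℕP.*-zeroʳ k)
  sumList-* (x ∷ xs) k w = trans (cong (k * w x +_) (sumList-* xs k w)) (sym (ℕP.*-distribˡ-+ k _ _))

  sumList-const : ∀ (xs : List A) k → sumList xs (λ _ → k) ≡ length xs * k
  sumList-const [] k = refl
  sumList-const (x ∷ xs) k = cong (k +_) (sumList-const xs k)

  sumList-zero : ∀ (xs : List A) → sumList xs (λ _ → 0) ≡ 0
  sumList-zero xs = trans (sumList-const xs 0) (ℕP.*-zeroʳ (length xs))

  sumList-swap : ∀ (xs : List A) (ys : List B) (w : A → B → ℕ) →
    sumList xs (λ x → sumList ys (w x)) ≡ sumList ys (λ y → sumList xs (λ x → w x y))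
  sumList-swap [] ys w = sym (sumList-zero ys)
  sumList-swap (x ∷ xs) ys w =
    trans (cong (sumList ys (w x) +_) (sumList-swap xs ys w)) (sym (sumList-+ ys (w x) _))

  sumList-map : ∀ (f : B → A) (ys : List B) (w : A → ℕ) →
    sumList (L.map f ys) w ≡ sumList ys (λ y → w (f y))
  sumList-map f [] w = refl
  sumList-map f (y ∷ ys) w = cong (w (f y) +_) (sumList-map f ys w)

  sumList-++ : ∀ (xs ys : List A) (w : A → ℕ) → sumList (xs L.++ ys) w ≡ sumList xs w + sumList ys w
  sumList-++ [] ys w = refl
  sumList-++ (x ∷ xs) ys w = trans (cong (w x +_) (sumList-++ xs ys w)) (sym (ℕP.+-assoc (w x) _ _))

  sumList-concatMap : ∀ (F : B → List A) (ys : List B) (w : A → ℕ) →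
    sumList (concatMap F ys) w ≡ sumList ys (λ y → sumList (F y) w)
  sumList-concatMap F [] w = refl
  sumList-concatMap F (y ∷ ys) w =
    trans (sumList-++ (F y) _ w) (cong (sumList (F y) w +_) (sumList-concatMap F ys w))

  length-filter : ∀ {p} {P : Pred A p} (P? : Decidable P) (xs : List A) →
    length (filter P? xs) ≡ sumList xs (λ x → ⟦ does (P? x) ⟧)
  length-filter P? [] = refl
  length-filter P? (x ∷ xs) with does (P? x)
  ... | true = cong suc (length-filter P? xs)
  ... | false = length-filter P? xs

  ΣFin : ∀ K → (Fin K → ℕ) → ℕ
  ΣFin K g = sumList (allFins K) g

  ΣFin-suc : ∀ K (g : Fin (suc K) → ℕ) → ΣFin (suc K) g ≡ g zero + ΣFin K (λ a → g (suc a))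
  ΣFin-suc K g = cong (g zero +_) (sumList-map suc (allFins K) g)

  ΣFin-const : ∀ K x → ΣFin K (λ _ → x) ≡ K * x
  ΣFin-const K x = trans (sumList-const (allFins K) x) (cong (_* x) (length-allFins K))
    where
    length-allFins : ∀ K → length (allFins K) ≡ K
    length-allFins zero = refl
    length-allFins (suc K) = cong suc (trans (LP.length-map suc (allFins K)) (length-allFins K))

  ΣCol : ∀ n K → (Coloring n K → ℕ) → ℕ
  ΣCol n K w = sumList (allColorings n K) w

  ΣCol-suc : ∀ n K (w : Coloring (suc n) K → ℕ) →
    ΣCol (suc n) K w ≡ ΣFin K (λ a → ΣCol n K (λ c → w (a ∷ c)))
  ΣCol-suc n K w =
    trans (sumList-concatMap (λ a → L.map (a ∷_) (allColorings n K)) (allFins K) w)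
          (sumList-cong (allFins K) (λ a → sumList-map (a ∷_) (allColorings n K) w))

  ΣCol-const : ∀ n K x → ΣCol n K (λ _ → x) ≡ K ^ n * x
  ΣCol-const zero K x = refl
  ΣCol-const (suc n) K x = begin
    ΣCol (suc n) K (λ _ → x)               ≡⟨ ΣCol-suc n K (λ _ → x) ⟩
    ΣFin K (λ _ → ΣCol n K (λ _ → x))      ≡⟨ sumList-cong (allFins K) (λ _ → ΣCol-const n K x) ⟩
    ΣFin K (λ _ → K ^ n * x)               ≡⟨ ΣFin-const K (K ^ n * x) ⟩
    K * (K ^ n * x)                        ≡⟨ ℕP.*-assoc K (K ^ n) x ⟨
    K ^ suc n * x ∎

  count≡ΣCol : ∀ n K {p} {P : Pred (Coloring n K) p} (P? : Decidable P) →
    length (filter P? (allColorings n K)) ≡ ΣCol n K (λ c → ⟦ does (P? c) ⟧)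
  count≡ΣCol n K P? = length-filter P? (allColorings n K)

module Relabelling where

  open ColouringSums
  open import Data.Nat using (ℕ; zero; suc; _+_; _*_; _≤_; _<_; _≡ᵇ_; s≤s)
  import Data.Nat.Properties as ℕP
  open import Data.Bool using (Bool; true; false; not; _∨_)
  open import Data.Fin using (Fin; zero; suc; toℕ)
  import Data.Fin.Properties as FP
  open import Data.Vec as V using ([]; _∷_)
  open import Relation.Binary.PropositionalEquality
  open ≡-Reasoning

  -- pin j : Fin K → Fin (suc K) keeps the colours below j and shifts the others up,
  -- so that its image misses exactly the colour j (for j ≤ K).
  pin : ∀ {K} → ℕ → Fin K → Fin (suc K)
  pin zero a = suc a
  pin (suc j) zero = zero
  pin (suc j) (suc a) = suc (pin j a)

  pin-injective : ∀ {K} j (a b : Fin K) → pin j a ≡ pin j b → a ≡ b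
  pin-injective zero a b refl = refl
  pin-injective (suc j) zero zero _ = refl
  pin-injective (suc j) (suc a) (suc b) eq = cong suc (pin-injective j a b (FP.suc-injective eq))

  pin-below : ∀ {K} j t (a : Fin K) → t < j → (toℕ (pin j a) ≡ᵇ t) ≡ (toℕ a ≡ᵇ t)
  pin-below (suc j) t zero _ = refl
  pin-below (suc j) zero (suc a) _ = refl
  pin-below (suc j) (suc t) (suc a) (s≤s t<j) = pin-below j t a t<j

  ΣFin-avoiding : ∀ K j → j ≤ K → (g : Fin (suc K) → ℕ) →
    ΣFin (suc K) (λ a → ⟦ not (toℕ a ≡ᵇ j) ⟧ * g a) ≡ ΣFin K (λ b → g (pin j b))
  ΣFin-avoiding K zero _ g =
    trans (ΣFin-suc K (λ a → ⟦ not (toℕ a ≡ᵇ 0) ⟧ * g a))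
          (sumList-cong (allFins K) (λ a → ℕP.*-identityˡ (g (suc a))))
  ΣFin-avoiding (suc K) (suc j) (s≤s j≤K) g = begin
    ΣFin (suc (suc K)) (λ a → ⟦ not (toℕ a ≡ᵇ suc j) ⟧ * g a)
      ≡⟨ ΣFin-suc (suc K) (λ a → ⟦ not (toℕ a ≡ᵇ suc j) ⟧ * g a) ⟩
    1 * g zero + ΣFin (suc K) (λ a → ⟦ not (toℕ a ≡ᵇ j) ⟧ * g (suc a))
      ≡⟨ cong₂ _+_ (ℕP.*-identityˡ (g zero)) (ΣFin-avoiding K j j≤K (λ a → g (suc a))) ⟩
    g zero + ΣFin K (λ b → g (suc (pin j b)))
      ≡⟨ ΣFin-suc K (λ b → g (pin (suc j) b)) ⟨
    ΣFin (suc K) (λ b → g (pin (suc j) b)) ∎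

  uses : ∀ {n K} → ℕ → Coloring n K → Bool
  uses t [] = false
  uses t (a ∷ c) = (toℕ a ≡ᵇ t) ∨ uses t c

  uses-pin : ∀ {n K} j t (d : Coloring n K) → t < j → uses t (V.map (pin j) d) ≡ uses t d
  uses-pin j t [] _ = refl
  uses-pin j t (a ∷ d) t<j = cong₂ _∨_ (pin-below j t a t<j) (uses-pin j t d t<j)

  ΣCol-avoiding : ∀ n K j → j ≤ K → (w : Coloring n (suc K) → ℕ) →
    ΣCol n (suc K) (λ c → ⟦ not (uses j c) ⟧ * w c) ≡ ΣCol n K (λ d → w (V.map (pin j) d))
  ΣCol-avoiding zero K j _ w = cong (_+ 0) (ℕP.*-identityˡ (w []))
  ΣCol-avoiding (suc n) K j j≤K w = begin
    ΣCol (suc n) (suc K) (λ c → ⟦ not (uses j c) ⟧ * w c)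
      ≡⟨ ΣCol-suc n (suc K) _ ⟩
    ΣFin (suc K) (λ a → ΣCol n (suc K) (λ c → ⟦ not ((toℕ a ≡ᵇ j) ∨ uses j c) ⟧ * w (a ∷ c)))
      ≡⟨ sumList-cong (allFins (suc K)) (λ a → factor a) ⟩
    ΣFin (suc K) (λ a → ⟦ not (toℕ a ≡ᵇ j) ⟧ * ΣCol n (suc K) (λ c → ⟦ not (uses j c) ⟧ * w (a ∷ c)))
      ≡⟨ ΣFin-avoiding K j j≤K _ ⟩
    ΣFin K (λ b → ΣCol n (suc K) (λ c → ⟦ not (uses j c) ⟧ * w (pin j b ∷ c)))
      ≡⟨ sumList-cong (allFins K) (λ b → ΣCol-avoiding n K j j≤K (λ c → w (pin j b ∷ c))) ⟩
    ΣFin K (λ b → ΣCol n K (λ d → w (pin j b ∷ V.map (pin j) d)))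
      ≡⟨ ΣCol-suc n K _ ⟨
    ΣCol (suc n) K (λ d → w (V.map (pin j) d)) ∎
    where
    split : ∀ x y v → ⟦ not (x ∨ y) ⟧ * v ≡ ⟦ not x ⟧ * (⟦ not y ⟧ * v)
    split true y v = refl
    split false true v = refl
    split false false v = cong (1 *_) (sym (ℕP.*-identityˡ v))
    factor : ∀ a → ΣCol n (suc K) (λ c → ⟦ not ((toℕ a ≡ᵇ j) ∨ uses j c) ⟧ * w (a ∷ c))
                 ≡ ⟦ not (toℕ a ≡ᵇ j) ⟧ * ΣCol n (suc K) (λ c → ⟦ not (uses j c) ⟧ * w (a ∷ c))
    factor a = trans (sumList-cong (allColorings n (suc K)) (λ c → split (toℕ a ≡ᵇ j) (uses j c) _))
                     (sumList-* (allColorings n (suc K)) ⟦ not (toℕ a ≡ᵇ j) ⟧ (λ c → ⟦ not (uses j c) ⟧ * w (a ∷ c)))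

module SurjectiveCounts where

  open FiniteSums
  open Differences
  open ColouringSums
  open Relabelling
  open import Data.Nat using (ℕ; zero; suc; _+_; _*_; _^_; _∸_; _≤_; _<_; _≤?_; s≤s)
  import Data.Nat.Properties as ℕP
  open import Data.Nat.Combinatorics using (_C_)
  open import Data.Integer as ℤ using (ℤ; +_)
  import Data.Integer.Properties as ℤP
  open import Data.Integer.Tactic.RingSolver using (solve-∀)
  open import Data.Bool using (Bool; true; false; not; _∧_; T)
  open import Data.Bool.Properties using (T-∨; T-∧)
  open import Data.Fin using (Fin; zero; suc; toℕ)
  import Data.Fin.Properties as FP
  open import Data.Vec as V using (lookup; _∷_)
  open import Data.List using (List)
  open import Data.Product using (Σ; _,_; proj₁; proj₂)
  open import Data.Sum using (inj₁; inj₂)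
  open import Data.Empty using (⊥-elim)
  open import Function using (_∘_)
  open import Function.Bundles using (Equivalence)
  open import Relation.Nullary using (yes; no)
  open import Relation.Binary.PropositionalEquality
  open ≡-Reasoning

  usesAll : ∀ {n K} → ℕ → Coloring n K → Bool
  usesAll zero c = true
  usesAll (suc j) c = usesAll j c ∧ uses j c

  usesAll-pin : ∀ {n K} j j′ (d : Coloring n K) → j′ ≤ j → usesAll j′ (V.map (pin j) d) ≡ usesAll j′ d
  usesAll-pin j zero d _ = refl
  usesAll-pin j (suc j′) d j′<j =
    cong₂ _∧_ (usesAll-pin j j′ d (ℕP.<⇒≤ j′<j)) (uses-pin j j′ d j′<j)

  positionOf : ∀ {n K} t (c : Coloring n K) → T (uses t c) → Σ (Fin n) λ v → toℕ (lookup c v) ≡ t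
  positionOf t (a ∷ c) used with Equivalence.to T-∨ used
  ... | inj₁ atHead = zero , ℕP.≡ᵇ⇒≡ (toℕ a) t atHead
  ... | inj₂ inTail = let v , colour = positionOf t c inTail in suc v , colour

  usesAll⇒uses : ∀ {n K} j (c : Coloring n K) → T (usesAll j c) → ∀ t → t < j → T (uses t c)
  usesAll⇒uses (suc j) c all t t<1+j with Equivalence.to T-∧ all | ℕP.m≤n⇒m<n∨m≡n t<1+j
  ... | allBelow , _ | inj₁ (s≤s t<j) = usesAll⇒uses j c allBelow t t<j
  ... | _ , usesTop  | inj₂ refl = usesTop

  colourPosition : ∀ {n K} j (c : Coloring n K) → T (usesAll j c) →
    (t : Fin j) → Σ (Fin n) λ v → toℕ (lookup c v) ≡ toℕ t
  colourPosition j c all t = positionOf (toℕ t) c (usesAll⇒uses j c all (toℕ t) (FP.toℕ<n t))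

  usesAll⇒≤ : ∀ {n K} j (c : Coloring n K) → T (usesAll j c) → j ≤ n
  usesAll⇒≤ {n} j c all with j ≤? n
  ... | yes j≤n = j≤n
  ... | no j≰n with FP.pigeonhole (ℕP.≰⇒> j≰n) (proj₁ ∘ colourPosition j c all)
  ... | t , t′ , t<t′ , samePosition = ⊥-elim (FP.<⇒≢ t<t′ (FP.toℕ-injective (begin
      toℕ t                    ≡⟨ proj₂ (position t) ⟨
      toℕ (lookup c (v t))     ≡⟨ cong (toℕ ∘ lookup c) samePosition ⟩
      toℕ (lookup c (v t′))    ≡⟨ proj₂ (position t′) ⟩
      toℕ t′ ∎)))
    where
    position : (t : Fin j) → Σ (Fin n) λ v → toℕ (lookup c v) ≡ toℕ t
    position = colourPosition j c all
    v : Fin j → Fin n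
    v = proj₁ ∘ position

  Weight : ℕ → Set
  Weight n = ∀ {K} → Coloring n K → ℕ

  RelabellingInvariant : ∀ {n} → Weight n → Set
  RelabellingInvariant {n} w = ∀ {K} j (d : Coloring n K) → w (V.map (pin j) d) ≡ w d

  surj : ∀ {n} K j → (Coloring n K → ℕ) → ℕ
  surj {n} K j w = ΣCol n K (λ c → ⟦ usesAll j c ⟧ * w c)

  surj-zero : ∀ {n} K (w : Coloring n K → ℕ) → surj K 0 w ≡ ΣCol n K w
  surj-zero {n} K w = sumList-cong (allColorings n K) (λ c → ℕP.*-identityˡ (w c))

  surj-mono : ∀ {n} K j {w w′ : Coloring n K → ℕ} → (∀ c → w c ≤ w′ c) → surj K j w ≤ surj K j w′
  surj-mono {n} K j w≤w′ =
    sumList-mono (allColorings n K) (λ c → ℕP.*-monoʳ-≤ ⟦ usesAll j c ⟧ (w≤w′ c))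

  surj-+ : ∀ {n} K j (w w′ : Coloring n K → ℕ) →
    surj K j (λ c → w c + w′ c) ≡ surj K j w + surj K j w′
  surj-+ {n} K j w w′ =
    trans (sumList-cong (allColorings n K) (λ c → ℕP.*-distribˡ-+ ⟦ usesAll j c ⟧ (w c) (w′ c)))
          (sumList-+ (allColorings n K) _ _)

  surj-sumList : ∀ {n} K j {A : Set} (xs : List A) (w : A → Coloring n K → ℕ) →
    surj K j (λ c → sumList xs (λ x → w x c)) ≡ sumList xs (λ x → surj K j (w x))
  surj-sumList {n} K j xs w =
    trans (sumList-cong (allColorings n K) (λ c → sym (sumList-* xs ⟦ usesAll j c ⟧ (λ x → w x c))))
          (sumList-swap (allColorings n K) xs _)

  -- No colouring of [n] uses more than n colours.
  surj-vanish : ∀ {n} K j (w : Coloring n K → ℕ) → n < j → surj K j w ≡ 0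
  surj-vanish {n} K j w n<j =
    trans (sumList-cong (allColorings n K) none) (sumList-zero (allColorings n K))
    where
    none : ∀ c → ⟦ usesAll j c ⟧ * w c ≡ 0
    none c with usesAll j c | usesAll⇒≤ j c
    ... | true | bound = ⊥-elim (ℕP.<⇒≱ n<j (bound _))
    ... | false | _ = refl

  -- Sorting the colourings by whether they use colour j.
  surj-pascal : ∀ {n} (w : Weight n) → RelabellingInvariant w → ∀ K j → j ≤ K →
    surj (suc K) j w ≡ surj K j w + surj (suc K) (suc j) w
  surj-pascal {n} w invariant K j j≤K = begin
    surj (suc K) j w
      ≡⟨ sumList-cong (allColorings n (suc K)) (λ c → split (usesAll j c) (uses j c) (w c)) ⟩
    ΣCol n (suc K) (λ c → ⟦ usesAll (suc j) c ⟧ * w c + ⟦ not (uses j c) ⟧ * (⟦ usesAll j c ⟧ * w c))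
      ≡⟨ sumList-+ (allColorings n (suc K)) _ _ ⟩
    surj (suc K) (suc j) w + ΣCol n (suc K) (λ c → ⟦ not (uses j c) ⟧ * (⟦ usesAll j c ⟧ * w c))
      ≡⟨ cong (_+_ (surj (suc K) (suc j) w)) (ΣCol-avoiding n K j j≤K _) ⟩
    surj (suc K) (suc j) w + ΣCol n K (λ d → ⟦ usesAll j (V.map (pin j) d) ⟧ * w (V.map (pin j) d))
      ≡⟨ cong (_+_ (surj (suc K) (suc j) w)) (sumList-cong (allColorings n K) relabelled) ⟩
    surj (suc K) (suc j) w + surj K j w
      ≡⟨ ℕP.+-comm (surj (suc K) (suc j) w) (surj K j w) ⟩
    surj K j w + surj (suc K) (suc j) w ∎
    where
    split : ∀ a u x → ⟦ a ⟧ * x ≡ ⟦ a ∧ u ⟧ * x + ⟦ not u ⟧ * (⟦ a ⟧ * x)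
    split false true x = refl
    split false false x = refl
    split true true x = sym (ℕP.+-identityʳ _)
    split true false x = sym (ℕP.*-identityˡ _)
    relabelled : ∀ d → ⟦ usesAll j (V.map (pin j) d) ⟧ * w (V.map (pin j) d) ≡ ⟦ usesAll j d ⟧ * w d
    relabelled d = cong₂ (λ u x → ⟦ u ⟧ * x) (usesAll-pin j j d ℕP.≤-refl) (invariant j d)

  total : ∀ {n} → Weight n → ℕ → ℤ
  total {n} w K = + ΣCol n K w

  surj-Δ : ∀ {n} (w : Weight n) → RelabellingInvariant w → ∀ b i →
    + surj (b + i) i w ≡ Δ i (total w) b
  surj-Δ w invariant b zero = cong +_ (trans (surj-zero (b + 0) w) (cong (λ K → ΣCol _ K w) (ℕP.+-identityʳ b)))
  surj-Δ w invariant b (suc i) = begin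
    + surj (b + suc i) (suc i) w
      ≡⟨ cong (λ K → + surj K (suc i) w) (ℕP.+-suc b i) ⟩
    + surj (suc (b + i)) (suc i) w
      ≡⟨ recurrence ⟩
    + surj (suc b + i) i w ℤ.- + surj (b + i) i w
      ≡⟨ cong₂ ℤ._-_ (surj-Δ w invariant (suc b) i) (surj-Δ w invariant b i) ⟩
    Δ (suc i) (total w) b ∎
    where
    cancel : ∀ (y z : ℤ) → z ≡ (y ℤ.+ z) ℤ.- y
    cancel = solve-∀
    recurrence : + surj (suc (b + i)) (suc i) w ≡ + surj (suc b + i) i w ℤ.- + surj (b + i) i w
    recurrence = trans (cancel (+ surj (b + i) i w) (+ surj (suc (b + i)) (suc i) w))
      (cong (ℤ._- + surj (b + i) i w)
            (cong +_ (sym (surj-pascal w invariant (b + i) i (ℕP.m≤n+m i b)))))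

  surj-fvector : ∀ {n} (w : Weight n) → RelabellingInvariant w →
    IsFVector n (λ k → total w (suc k)) (λ i → + surj (2 + i) i w)
  surj-fvector {n} w invariant m = begin
    total w (2 + m)
      ≡⟨ newton (total w) m 2 ⟩
    Σ[0… m ] (λ i → Δ i (total w) 2 ℤ.* + (m C i))
      ≡⟨ Σ-cong m (λ i _ → cong (ℤ._* + (m C i)) (sym (surj-Δ w invariant 2 i))) ⟩
    Σ[0… m ] g
      ≡⟨ extend ⟩
    Σ[0… n ] g ∎
    where
    g : ℕ → ℤ
    g i = + surj (2 + i) i w ℤ.* + (m C i)
    beyondColourings : ∀ i → n < i → g i ≡ ℤ.0ℤ
    beyondColourings i n<i =
      trans (cong (λ z → + z ℤ.* + (m C i)) (surj-vanish (2 + i) i w n<i)) (ℤP.*-zeroˡ (+ (m C i)))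
    extend : Σ[0… m ] g ≡ Σ[0… n ] g
    extend with m ≤? n
    ... | yes m≤n = sym (Σ-truncate m n g (binomial-tail m (λ i → + surj (2 + i) i w)) m≤n)
    ... | no m≰n = Σ-truncate n m g beyondColourings (ℕP.<⇒≤ (ℕP.≰⇒> m≰n))

  surj-power : ∀ {n} (w : Weight n) → RelabellingInvariant w → ∀ p → (∀ K → ΣCol n K w ≡ K ^ p) →
    ∀ b i → + surj (b + i) i w ≡ Σ[0… i ] (λ c → sgn c ℤ.* + (i C c) ℤ.* + ((i ∸ c + b) ^ p))
  surj-power w invariant p power b i =
    trans (surj-Δ w invariant b i)
          (trans (Δ-cong i (λ K → cong +_ (power K)) b) (Δ-explicit i (λ K → + (K ^ p)) b))

module HypergraphColourings where

  open ColouringSums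
  open Relabelling
  open SurjectiveCounts using (Weight; RelabellingInvariant)
  open import Data.Nat using (ℕ; zero; suc; _+_; _*_; _^_; _∸_; _≤_; _≡ᵇ_; s≤s; z≤n)
  import Data.Nat.Properties as ℕP
  open import Data.Bool using (Bool; true; false; _∧_; T)
  open import Data.Bool.Properties using (T-∧)
  open import Data.Fin using (Fin; zero; suc; toℕ)
  import Data.Fin.Properties as FP
  open import Data.Fin.Subset using (Subset; _∈_; ∣_∣)
  open import Data.Fin.Subset.Properties using (_∈?_; ∣p∣≤n)
  open import Data.Vec as V using ([]; _∷_; lookup; here; there)
  import Data.Vec.Properties as VP
  open import Data.List using (List; []; _∷_)
  open import Data.List.Relation.Unary.All as All using (All)
  open import Data.Product using (_,_; proj₁; proj₂)
  open import Data.Empty using (⊥-elim)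
  open import Function.Bundles using (Equivalence; mk⇔)
  open import Relation.Nullary using (does; yes; no; ¬?)
  open import Relation.Nullary.Decidable using (does-⇔; T?)
  open import Relation.Binary.PropositionalEquality
  open ≡-Reasoning

  properW : ∀ {n} → Hypergraph n → Weight n
  properW H c = ⟦ does (proper? H c) ⟧

  monoW : ∀ {n} → Subset n → Weight n
  monoW e c = ⟦ does (monochromatic? c e) ⟧

  -- Monochromaticity is preserved and reflected by the injective relabelling pin j
  -- (reflection picks the colour of vertex 0 when the edge is empty).
  module _ {n K : ℕ} (j : ℕ) (d : Coloring (suc n) K) (e : Subset (suc n)) where

    monochromatic-reflect : Monochromatic (V.map (pin j) d) e → Monochromatic d e
    monochromatic-reflect (a , same) with FP.any? (λ v → v ∈? e)
    ... | yes (v₀ , v₀∈e) = lookup d v₀ , λ v v∈e → pin-injective j _ _ (begin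
          pin j (lookup d v)              ≡⟨ VP.lookup-map v (pin j) d ⟨
          lookup (V.map (pin j) d) v      ≡⟨ same v v∈e ⟩
          a                               ≡⟨ same v₀ v₀∈e ⟨
          lookup (V.map (pin j) d) v₀     ≡⟨ VP.lookup-map v₀ (pin j) d ⟩
          pin j (lookup d v₀) ∎)
    ... | no empty = lookup d zero , λ v v∈e → ⊥-elim (empty (v , v∈e))

    monochromatic-preserve : Monochromatic d e → Monochromatic (V.map (pin j) d) e
    monochromatic-preserve (a , same) =
      pin j a , λ v v∈e → trans (VP.lookup-map v (pin j) d) (cong (pin j) (same v v∈e))

  monoW-invariant : ∀ {n} (e : Subset (suc n)) → RelabellingInvariant (monoW e)
  monoW-invariant e j d = cong ⟦_⟧ (does-⇔ (mk⇔ (monochromatic-reflect j d e) (monochromatic-preserve j d e))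
                                         (monochromatic? (V.map (pin j) d) e) (monochromatic? d e))

  properW-invariant : ∀ {n} (H : Hypergraph (suc n)) → RelabellingInvariant (properW H)
  properW-invariant H j d = cong ⟦_⟧ (does-⇔ (mk⇔ to from) (proper? H (V.map (pin j) d)) (proper? H d))
    where
    to : Proper H (V.map (pin j) d) → Proper H d
    to = All.map (λ {e} notMono mono → notMono (monochromatic-preserve j d e mono))
    from : Proper H d → Proper H (V.map (pin j) d)
    from = All.map (λ {e} notMono mono → notMono (monochromatic-reflect j d e mono))

  constantOn : ∀ {n K} → Fin K → Coloring n K → Subset n → Bool
  constantOn a [] [] = true
  constantOn a (x ∷ c) (true ∷ e) = (toℕ x ≡ᵇ toℕ a) ∧ constantOn a c e
  constantOn a (x ∷ c) (false ∷ e) = constantOn a c e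

  constantOn-sound : ∀ {n K} a (c : Coloring n K) e → T (constantOn a c e) → ∀ v → v ∈ e → lookup c v ≡ a
  constantOn-sound a (x ∷ c) (true ∷ e) const zero here =
    FP.toℕ-injective (ℕP.≡ᵇ⇒≡ _ _ (proj₁ (Equivalence.to T-∧ const)))
  constantOn-sound a (x ∷ c) (true ∷ e) const (suc v) (there v∈e) =
    constantOn-sound a c e (proj₂ (Equivalence.to T-∧ const)) v v∈e
  constantOn-sound a (x ∷ c) (false ∷ e) const (suc v) (there v∈e) = constantOn-sound a c e const v v∈e

  constantOn-complete : ∀ {n K} a (c : Coloring n K) e → (∀ v → v ∈ e → lookup c v ≡ a) → T (constantOn a c e)
  constantOn-complete a [] [] _ = _
  constantOn-complete a (x ∷ c) (true ∷ e) const = Equivalence.from T-∧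
    (ℕP.≡⇒≡ᵇ _ _ (cong toℕ (const zero here)) , constantOn-complete a c e (λ v v∈e → const (suc v) (there v∈e)))
  constantOn-complete a (x ∷ c) (false ∷ e) const = constantOn-complete a c e (λ v v∈e → const (suc v) (there v∈e))

  ΣFin-single : ∀ K (a : Fin K) (g : Fin K → ℕ) → ΣFin K (λ x → ⟦ toℕ x ≡ᵇ toℕ a ⟧ * g x) ≡ g a
  ΣFin-single (suc K) zero g = begin
    ΣFin (suc K) (λ x → ⟦ toℕ x ≡ᵇ 0 ⟧ * g x)     ≡⟨ ΣFin-suc K (λ x → ⟦ toℕ x ≡ᵇ 0 ⟧ * g x) ⟩
    1 * g zero + ΣFin K (λ _ → 0)                   ≡⟨ cong₂ _+_ (ℕP.*-identityˡ (g zero)) (sumList-zero (allFins K)) ⟩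
    g zero + 0                                      ≡⟨ ℕP.+-identityʳ (g zero) ⟩
    g zero ∎
  ΣFin-single (suc K) (suc a) g = trans (ΣFin-suc K (λ x → ⟦ toℕ x ≡ᵇ toℕ (suc a) ⟧ * g x)) (ΣFin-single K a (λ x → g (suc x)))

  -- The colourings constant (= a) on e: the other n - |e| vertices are free.
  ΣCol-constantOn : ∀ {n} K a (e : Subset n) → ΣCol n K (λ c → ⟦ constantOn a c e ⟧) ≡ K ^ (n ∸ ∣ e ∣)
  ΣCol-constantOn {zero} K a [] = refl
  ΣCol-constantOn {suc n} K a (true ∷ e) = begin
    ΣCol (suc n) K (λ c → ⟦ constantOn a c (true ∷ e) ⟧)
      ≡⟨ ΣCol-suc n K _ ⟩
    ΣFin K (λ x → ΣCol n K (λ c → ⟦ (toℕ x ≡ᵇ toℕ a) ∧ constantOn a c e ⟧))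
      ≡⟨ sumList-cong (allFins K) (λ x → trans (sumList-cong (allColorings n K) (λ c → ⟦∧⟧ (toℕ x ≡ᵇ toℕ a) _))
                                               (sumList-* (allColorings n K) ⟦ toℕ x ≡ᵇ toℕ a ⟧ (λ c → ⟦ constantOn a c e ⟧))) ⟩
    ΣFin K (λ x → ⟦ toℕ x ≡ᵇ toℕ a ⟧ * ΣCol n K (λ c → ⟦ constantOn a c e ⟧))
      ≡⟨ ΣFin-single K a _ ⟩
    ΣCol n K (λ c → ⟦ constantOn a c e ⟧)
      ≡⟨ ΣCol-constantOn K a e ⟩
    K ^ (n ∸ ∣ e ∣) ∎
    where
    ⟦∧⟧ : ∀ x y → ⟦ x ∧ y ⟧ ≡ ⟦ x ⟧ * ⟦ y ⟧
    ⟦∧⟧ true y = sym (ℕP.*-identityˡ ⟦ y ⟧)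
    ⟦∧⟧ false y = refl
  ΣCol-constantOn {suc n} K a (false ∷ e) = begin
    ΣCol (suc n) K (λ c → ⟦ constantOn a c (false ∷ e) ⟧)
      ≡⟨ ΣCol-suc n K _ ⟩
    ΣFin K (λ _ → ΣCol n K (λ c → ⟦ constantOn a c e ⟧))
      ≡⟨ sumList-cong (allFins K) (λ _ → ΣCol-constantOn K a e) ⟩
    ΣFin K (λ _ → K ^ (n ∸ ∣ e ∣))
      ≡⟨ ΣFin-const K _ ⟩
    K ^ suc (n ∸ ∣ e ∣)
      ≡⟨ cong (K ^_) (ℕP.+-∸-assoc 1 (∣p∣≤n e)) ⟨
    K ^ (suc n ∸ ∣ e ∣) ∎

  monochromatic-head∈ : ∀ {n K} x (c : Coloring n K) e →
    does (monochromatic? (x ∷ c) (true ∷ e)) ≡ constantOn x c e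
  monochromatic-head∈ x c e = does-⇔ (mk⇔ to from) (monochromatic? (x ∷ c) (true ∷ e)) (T? (constantOn x c e))
    where
    to : Monochromatic (x ∷ c) (true ∷ e) → T (constantOn x c e)
    to (a , same) = constantOn-complete x c e (λ v v∈e → trans (same (suc v) (there v∈e)) (sym (same zero here)))
    from : T (constantOn x c e) → Monochromatic (x ∷ c) (true ∷ e)
    from const = x , λ { zero here → refl ; (suc v) (there v∈e) → constantOn-sound x c e const v v∈e }

  monochromatic-head∉ : ∀ {n K} x (c : Coloring n K) e →
    does (monochromatic? (x ∷ c) (false ∷ e)) ≡ does (monochromatic? c e)
  monochromatic-head∉ x c e = does-⇔ (mk⇔ to from) (monochromatic? (x ∷ c) (false ∷ e)) (monochromatic? c e)
    where
    to : Monochromatic (x ∷ c) (false ∷ e) → Monochromatic c e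
    to (a , same) = a , λ v v∈e → same (suc v) (there v∈e)
    from : Monochromatic c e → Monochromatic (x ∷ c) (false ∷ e)
    from (a , same) = a , λ { (suc v) (there v∈e) → same v v∈e }

  ΣCol-monochromatic : ∀ {n} K (e : Subset n) → 1 ≤ ∣ e ∣ → ΣCol n K (monoW e) ≡ K ^ suc (n ∸ ∣ e ∣)
  ΣCol-monochromatic {suc n} K (true ∷ e) _ = begin
    ΣCol (suc n) K (monoW (true ∷ e))
      ≡⟨ ΣCol-suc n K _ ⟩
    ΣFin K (λ x → ΣCol n K (λ c → monoW (true ∷ e) (x ∷ c)))
      ≡⟨ sumList-cong (allFins K) (λ x → sumList-cong (allColorings n K) (λ c → cong ⟦_⟧ (monochromatic-head∈ x c e))) ⟩
    ΣFin K (λ x → ΣCol n K (λ c → ⟦ constantOn x c e ⟧))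
      ≡⟨ sumList-cong (allFins K) (λ x → ΣCol-constantOn K x e) ⟩
    ΣFin K (λ _ → K ^ (n ∸ ∣ e ∣))
      ≡⟨ ΣFin-const K _ ⟩
    K ^ suc (n ∸ ∣ e ∣) ∎
  ΣCol-monochromatic {suc n} K (false ∷ e) nonempty = begin
    ΣCol (suc n) K (monoW (false ∷ e))
      ≡⟨ ΣCol-suc n K _ ⟩
    ΣFin K (λ x → ΣCol n K (λ c → monoW (false ∷ e) (x ∷ c)))
      ≡⟨ sumList-cong (allFins K) (λ x → sumList-cong (allColorings n K) (λ c → cong ⟦_⟧ (monochromatic-head∉ x c e))) ⟩
    ΣFin K (λ _ → ΣCol n K (monoW e))
      ≡⟨ sumList-cong (allFins K) (λ _ → ΣCol-monochromatic K e nonempty) ⟩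
    ΣFin K (λ _ → K ^ suc (n ∸ ∣ e ∣))
      ≡⟨ ΣFin-const K _ ⟩
    K ^ suc (suc (n ∸ ∣ e ∣))
      ≡⟨ cong (λ z → K ^ suc z) (ℕP.+-∸-assoc 1 (∣p∣≤n e)) ⟨
    K ^ suc (suc n ∸ ∣ e ∣) ∎

  proper-or-monochromatic : ∀ {n K} (c : Coloring n K) (es : List (Subset n)) →
    1 ≤ ⟦ does (All.all? (λ e → ¬? (monochromatic? c e)) es) ⟧ + sumList es (λ e → monoW e c)
  proper-or-monochromatic c [] = s≤s z≤n
  proper-or-monochromatic c (e ∷ es) with monochromatic? c e
  ... | yes _ = s≤s z≤n
  ... | no _ = proper-or-monochromatic c es

open import Data.Nat as ℕ using (ℕ; zero; suc; _≤_; _∸_; _^_; z≤n; s≤s)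
import Data.Nat.Properties as ℕP
open import Data.Nat.Combinatorics using (_C_)
open import Data.Integer as ℤ using (ℤ; +_; _-_; _*_)
import Data.Integer.Properties as ℤP
open import Data.Integer.Tactic.RingSolver using (solve-∀)
open import Data.Fin.Subset using (Subset; ∣_∣)
open import Data.List using (List; []; _∷_; length)
open import Data.List.Relation.Unary.All using (All; []; _∷_)
open import Data.Product using (Σ; _×_; _,_)
open import Relation.Nullary using (does)
open import Relation.Binary.PropositionalEquality
open ≡-Reasoning
open FiniteSums using (Σ-cong; Σ--; Σ-*ˡ)
open Differences using (fvector-unique)
open ColouringSums using (⟦⟧≤1; sumList; ΣCol; ΣCol-const; count≡ΣCol)
open SurjectiveCounts using (Weight; surj; surj-mono; surj-+; surj-sumList; surj-fvector; surj-power)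
open HypergraphColourings

-- The alternating sum Σ_{c ≤ i} (-1)^c C(i, c) (i - c + 2)^p = Δ^i K^p at K = 2.
alternatingPowers : ℕ → ℕ → ℤ
alternatingPowers p i = Σ[0… i ] (λ c → sgn c * + (i C c) * + ((i ∸ c ℕ.+ 2) ^ p))

module Corollary {n′ r : ℕ} (2≤r : 2 ≤ r) (H : Hypergraph (suc n′)) (uniform : Uniform r H) where

  N : ℕ
  N = suc n′

  fχ : ℕ → ℤ
  fχ i = + surj (2 ℕ.+ i) i (properW H)

  fχ-isFVector : IsFVector N (λ k → + χ H (suc k)) fχ
  fχ-isFVector m =
    trans (cong +_ (count≡ΣCol N (2 ℕ.+ m) (proper? H))) (surj-fvector (properW H) (properW-invariant H) m)

  one : Weight N
  one _ = 1

  surj-one : ∀ i → + surj (2 ℕ.+ i) i one ≡ alternatingPowers N i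
  surj-one = surj-power one (λ _ _ → refl) N (λ K → trans (ΣCol-const N K 1) (ℕP.*-identityʳ (K ^ N))) 2

  surj-edge : ∀ e → ∣ e ∣ ≡ r → ∀ i → + surj (2 ℕ.+ i) i (monoW e) ≡ alternatingPowers (N ∸ r ℕ.+ 1) i
  surj-edge e size = surj-power (monoW e) (monoW-invariant e) (N ∸ r ℕ.+ 1) count 2
    where
    nonempty : 1 ≤ ∣ e ∣
    nonempty = subst (1 ≤_) (sym size) (ℕP.≤-trans (s≤s z≤n) 2≤r)
    count : ∀ K → ΣCol N K (monoW e) ≡ K ^ (N ∸ r ℕ.+ 1)
    count K = trans (ΣCol-monochromatic K e nonempty)
                    (cong (λ s → K ^ s) (trans (cong (λ s → suc (N ∸ s)) size) (ℕP.+-comm 1 (N ∸ r))))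

  surj-edges : ∀ i (es : List (Subset N)) → All (λ e → ∣ e ∣ ≡ r) es →
    + sumList es (λ e → surj (2 ℕ.+ i) i (monoW e)) ≡ + length es * alternatingPowers (N ∸ r ℕ.+ 1) i
  surj-edges i [] [] = refl
  surj-edges i (e ∷ es) (size ∷ sizes) = begin
    + (surj (2 ℕ.+ i) i (monoW e) ℕ.+ sumList es (λ e → surj (2 ℕ.+ i) i (monoW e)))
      ≡⟨ ℤP.pos-+ (surj (2 ℕ.+ i) i (monoW e)) _ ⟩
    + surj (2 ℕ.+ i) i (monoW e) ℤ.+ + sumList es (λ e → surj (2 ℕ.+ i) i (monoW e))
      ≡⟨ cong₂ ℤ._+_ (surj-edge e size i) (surj-edges i es sizes) ⟩
    M ℤ.+ + length es * M
      ≡⟨ collect (+ length es) M ⟩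
    (+ 1 ℤ.+ + length es) * M ∎
    where
    M : ℤ
    M = alternatingPowers (N ∸ r ℕ.+ 1) i
    collect : ∀ (l m : ℤ) → m ℤ.+ l * m ≡ (+ 1 ℤ.+ l) * m
    collect = solve-∀

  edgeTerm : ℕ → ℤ
  edgeTerm i = + #E H * alternatingPowers (N ∸ r ℕ.+ 1) i

  -- By the union bound every colouring is proper or has a monochromatic edge.
  surj-union : ∀ i → alternatingPowers N i ℤ.≤ fχ i ℤ.+ edgeTerm i
  surj-union i = subst₂ ℤ._≤_ (surj-one i) split (ℤ.+≤+ (surj-mono K i covered))
    where
    K : ℕ
    K = 2 ℕ.+ i
    covered : ∀ c → one c ≤ properW H c ℕ.+ sumList (edges H) (λ e → monoW e c)
    covered c = proper-or-monochromatic c (edges H)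
    split : + surj K i (λ c → properW H c ℕ.+ sumList (edges H) (λ e → monoW e c))
            ≡ fχ i ℤ.+ edgeTerm i
    split = begin
      + surj K i (λ c → properW H c ℕ.+ sumList (edges H) (λ e → monoW e c))
        ≡⟨ cong +_ (surj-+ K i (properW H) (λ c → sumList (edges H) (λ e → monoW e c))) ⟩
      + (surj K i (properW H) ℕ.+ surj K i (λ c → sumList (edges H) (λ e → monoW e c)))
        ≡⟨ cong (λ x → + (surj K i (properW H) ℕ.+ x)) (surj-sumList K i (edges H) (λ e → monoW e)) ⟩
      + (surj K i (properW H) ℕ.+ sumList (edges H) (λ e → surj K i (monoW e)))
        ≡⟨ ℤP.pos-+ (surj K i (properW H)) _ ⟩
      fχ i ℤ.+ + sumList (edges H) (λ e → surj K i (monoW e))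
        ≡⟨ cong (ℤ._+_ (fχ i)) (surj-edges i (edges H) uniform) ⟩
      fχ i ℤ.+ edgeTerm i ∎

  lowerSum : ℕ → ℤ
  lowerSum i = Σ[0… i ] (λ c → sgn c * + (i C c) * (+ ((i ∸ c ℕ.+ 2) ^ N) - + #E H * + ((i ∸ c ℕ.+ 2) ^ (N ∸ r ℕ.+ 1))))

  lowerSum-split : ∀ i → lowerSum i ≡ alternatingPowers N i - edgeTerm i
  lowerSum-split i = begin
    lowerSum i
      ≡⟨ Σ-cong i (λ c _ → expand (sgn c) (+ (i C c)) (+ ((i ∸ c ℕ.+ 2) ^ N)) E (+ ((i ∸ c ℕ.+ 2) ^ (N ∸ r ℕ.+ 1)))) ⟩
    Σ[0… i ] (λ c → sgn c * + (i C c) * + ((i ∸ c ℕ.+ 2) ^ N)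
                     - E * (sgn c * + (i C c) * + ((i ∸ c ℕ.+ 2) ^ (N ∸ r ℕ.+ 1))))
      ≡⟨ Σ-- i _ _ ⟩
    alternatingPowers N i - Σ[0… i ] (λ c → E * (sgn c * + (i C c) * + ((i ∸ c ℕ.+ 2) ^ (N ∸ r ℕ.+ 1))))
      ≡⟨ cong (alternatingPowers N i -_) (Σ-*ˡ i E _) ⟩
    alternatingPowers N i - E * alternatingPowers (N ∸ r ℕ.+ 1) i ∎
    where
    E : ℤ
    E = + #E H
    expand : ∀ (s k a e b : ℤ) → s * k * (a - e * b) ≡ s * k * a - e * (s * k * b)
    expand = solve-∀

  fχ-bounds : ∀ i → (lowerSum i ℤ.≤ fχ i) × (fχ i ℤ.≤ alternatingPowers N i)
  fχ-bounds i = lower , upper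
    where
    upper : fχ i ℤ.≤ alternatingPowers N i
    upper = subst (fχ i ℤ.≤_) (surj-one i)
                  (ℤ.+≤+ (surj-mono (2 ℕ.+ i) i (λ c → ⟦⟧≤1 (does (proper? H c)))))
    cancel : ∀ (a m : ℤ) → a ℤ.+ m - m ≡ a
    cancel = solve-∀
    lower : lowerSum i ℤ.≤ fχ i
    lower = subst₂ ℤ._≤_ (sym (lowerSum-split i)) (cancel (fχ i) (edgeTerm i))
                   (ℤP.+-monoˡ-≤ (ℤ.- edgeTerm i) (surj-union i))

corollary4p5 : ∀ (n : ℕ) → 1 ≤ n → ∀ (r : ℕ) → 2 ≤ r →
    (H : Hypergraph n) → Uniform r H →
    Σ (ℕ → ℤ) (IsFVector n (λ k → + χ H (suc k)))
    × (∀ (f : ℕ → ℤ) → IsFVector n (λ k → + χ H (suc k)) f →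
       ∀ (i : ℕ) → i ≤ n →
         (Σ[0… i ] (λ c → sgn c * + (i C c) * (+ ((i ∸ c ℕ.+ 2) ^ n) - + #E H * + ((i ∸ c ℕ.+ 2) ^ (n ∸ r ℕ.+ 1)))) ℤ.≤ f i)
         × (f i ℤ.≤ Σ[0… i ] (λ c → sgn c * + (i C c) * + ((i ∸ c ℕ.+ 2) ^ n))))
corollary4p5 zero () r 2≤r H uniform
corollary4p5 (suc n′) _ r 2≤r H uniform =
  (fχ , fχ-isFVector) ,
  λ f f-is i i≤n → subst (λ x → (lowerSum i ℤ.≤ x) × (x ℤ.≤ alternatingPowers (suc n′) i))
                         (sym (fvector-unique (suc n′) (λ k → + χ H (suc k)) f fχ f-is fχ-isFVector i i≤n))
                         (fχ-bounds i)
  where open Corollary 2≤r H uniform
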